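{- Let $B$ be a unital algebra over a field of characteristic zero and $f,g\in I\cdot\mathrm{Mult}[[B]]$. Then $$f\boxplus g=(f\boxplus_1 g)\cdot(f\boxplus_2 g),\qquad g\,\underline\boxplus\,f=(f\boxplus_2 g)\cdot(f\boxplus_1 g).$$
   Context: $\mathrm{Mult}[[B]]$: sequences $f=(f_n)_{n\ge0}$, $f_n:B^n\to B$ multilinear ($f_0\in B$). $(f\cdot g)_n(x_1,\dots,x_n)=\sum_kf_k(x_1,\dots,x_k)g_{n-k}(x_{k+1},\dots,x_n)$; $I_1=\mathrm{Id}_B$, $I_n=0$ otherwise; $I\cdot\mathrm{Mult}[[B]]=\{I\cdot F:F\in\mathrm{Mult}[[B]]\}$. Trees: $Y_0=\{|\}$, $Y_n=\{\sigma\vee\tau:\sigma\in Y_k,\tau\in Y_l,k+l=n-1\}$ ($\sigma\vee\tau$: root with left subtree $\sigma$, right subtree $\tau$). Each $\tau\in Y_n$, $n\ge1$, is uniquely $\tau_1\vee(\tau_2\vee(\cdots\vee(\tau_k\vee|)))$; $j_i=|\tau_1|+\dots+|\tau_i|+i$. $(f\cup g)_|=1$, $(f\cup g)_\tau(x_1,\dots,x_n)=g_k((g\cup f)_{\tau_1}(x_1,\dots,x_{j_1-1})x_{j_1},\dots,(g\cup f)_{\tau_k}(x_{j_{k-1}+1},\dots,x_{j_k-1})x_{j_k})$. $R(|)=|$, $R(\sigma\vee\tau)=(|\vee R(\sigma))\vee R(\tau)$. For $n\ge1$: $(f\boxplus g)_n(x_1,\dots,x_n)=\sum_{\tau\in Y_n}(f\cup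 g)_{R(\tau)}(x_1,1,x_2,1,\dots,1,x_n,1)$, $(f\boxplus g)_0=g_0$; $(f\,\underline\boxplus\, g)_n(x_1,\dots,x_n)=\sum_{\tau\in Y_n}(f\cup g)_{R(\tau)}(1,x_1,1,x_2,\dots,1,x_n)$, $(f\,\underline\boxplus\,g)_0=g_0$; $(f\boxplus_1 g)_n(x_1,\dots,x_n)=\sum_{\tau\in Y_{n-1}}(g\cup f)_{|\vee R(\tau)}(x_1,1,x_2,1,\dots,1,x_n)$, $(f\boxplus_1g)_0=0$; $(f\boxplus_2 g)_n(x_1,\dots,x_n)=\sum_{\tau\in Y_n}(f\cup g)_{|\vee R(\tau)}(1,x_1,1,x_2,1,\dots,1,x_n,1)$, $(f\boxplus_2g)_0=g_1(1)$. -}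

module Defs where

open import Level using (Level; _⊔_) renaming (suc to lsuc)
open import Data.Nat using (ℕ; zero; suc; _∸_)
open import Data.Product using (Σ; _×_; _,_)
open import Data.List using (List; []; _∷_; _++_; map; concat; concatMap; zipWith; reverse; take; drop; length; upTo; foldr)
open import Data.List.Relation.Binary.Pointwise using (Pointwise)
open import Relation.Nullary using (¬_)
open import Algebra.Bundles using (CommutativeRing; Ring)

record Field (k ℓ : Level) : Set (lsuc (k ⊔ ℓ)) where
  field
    commutativeRing : CommutativeRing k ℓ
  open CommutativeRing commutativeRing public
  field
    1≉0     : ¬ (1# ≈ 0#)
    inverse : ∀ x → ¬ (x ≈ 0#) → Σ Carrier λ y → (x * y) ≈ 1#

module _ {k ℓ} (K : Field k ℓ) where
  open Field K
  fromℕ : ℕ → Carrier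
  fromℕ zero    = 0#
  fromℕ (suc n) = 1# + fromℕ n

  CharZero : Set ℓ
  CharZero = ∀ n → ¬ (fromℕ (suc n) ≈ 0#)

record UnitalAlgebra {k ℓk} (K : Field k ℓk) (b ℓb : Level)
       : Set (k ⊔ ℓk ⊔ lsuc (b ⊔ ℓb)) where
  private module K = Field K
  field
    ring : Ring b ℓb
  open Ring ring public
  infixr 7 _·_
  field
    _·_       : K.Carrier → Carrier → Carrier
    ·-cong    : ∀ {r s x y} → r K.≈ s → x ≈ y → (r · x) ≈ (s · y)
    ·-distribˡ : ∀ r x y → (r · (x + y)) ≈ ((r · x) + (r · y))
    ·-distribʳ : ∀ r s x → ((r K.+ s) · x) ≈ ((r · x) + (s · x))
    ·-assoc   : ∀ r s x → ((r K.* s) · x) ≈ (r · (s · x))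
    ·-identity : ∀ x → (K.1# · x) ≈ x
    ·-*ˡ      : ∀ r x y → (r · (x * y)) ≈ ((r · x) * y)
    ·-*ʳ      : ∀ r x y → (r · (x * y)) ≈ (x * (r · y))

-- Mult[[B]]: a sequence (f_n) of maps f_n : B^n → B is encoded as a
-- single function List B → B (f_n = restriction to lists of length n).

module Series {k ℓk b ℓb} {K : Field k ℓk} (A : UnitalAlgebra K b ℓb) where
  open UnitalAlgebra A

  Seq : Set b
  Seq = List Carrier → Carrier

  record Multilinear (f : Seq) : Set (k ⊔ b ⊔ ℓb) where
    field
      cong : ∀ {xs ys} → Pointwise _≈_ xs ys → f xs ≈ f ys
      additive : ∀ xs ys x y →
        f (xs ++ (x + y) ∷ ys) ≈ (f (xs ++ x ∷ ys) + f (xs ++ y ∷ ys))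
      homogeneous : ∀ xs ys r x →
        f (xs ++ (r · x) ∷ ys) ≈ (r · f (xs ++ x ∷ ys))

  ΣB : List Carrier → Carrier
  ΣB = foldr _+_ 0#

  _⊙_ : Seq → Seq → Seq
  (f ⊙ g) xs = ΣB (map (λ j → f (take j xs) * g (drop j xs)) (upTo (suc (length xs))))

  I : Seq
  I (x ∷ []) = x
  I _        = 0#

  InIMult : Seq → Set (k ⊔ b ⊔ ℓb)
  InIMult f = Σ Seq λ F → Multilinear F × (∀ xs → f xs ≈ (I ⊙ F) xs)

data Tree : Set where
  ∣  : Tree
  _∨_ : Tree → Tree → Tree

size : Tree → ℕ
size ∣       = 0
size (σ ∨ τ) = suc (size σ + size τ)
  where open Data.Nat using (_+_)

joins : List Tree → List Tree → List Tree
joins A B = concatMap (λ σ → map (σ ∨_) B) A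

-- Ys n = [Y_n , Y_{n-1} , … , Y_0];  Y_{n+1} = ⋃_{k+l=n} {σ ∨ τ : σ ∈ Y_k, τ ∈ Y_l}
nextY : List (List Tree) → List Tree
nextY L = concat (zipWith joins (reverse L) L)

Ys : ℕ → List (List Tree)
Ys zero    = (∣ ∷ []) ∷ []
Ys (suc n) = nextY (Ys n) ∷ Ys n

Y : ℕ → List Tree
Y zero    = ∣ ∷ []
Y (suc n) = nextY (Ys n)

R : Tree → Tree
R ∣       = ∣
R (σ ∨ τ) = (∣ ∨ R σ) ∨ R τ

module Convolutions {k ℓk b ℓb} {K : Field k ℓk} (A : UnitalAlgebra K b ℓb) where
  open UnitalAlgebra A
  open Series A

  -- default value only used on ill-sized argument lists (never in the statement)
  headOr : List Carrier → Carrier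
  headOr []      = 0#
  headOr (x ∷ _) = x

  mutual
    -- (f ∪ g)_τ(x_1..x_n); τ = τ_1 ∨ (τ_2 ∨ (⋯ ∨ (τ_k ∨ ∣)))
    cup : Seq → Seq → Tree → List Carrier → Carrier
    cup f g ∣       xs = 1#
    cup f g (t ∨ r) xs = g (cupArgs f g (t ∨ r) xs)

    -- the k arguments (g ∪ f)_{τ_i}(x_{j_{i-1}+1}..x_{j_i - 1}) x_{j_i}
    cupArgs : Seq → Seq → Tree → List Carrier → List Carrier
    cupArgs f g ∣       xs = []
    cupArgs f g (t ∨ r) xs =
      (cup g f t (take (size t) xs) * headOr (drop (size t) xs))
        ∷ cupArgs f g r (drop (suc (size t)) xs)

  x1s : List Carrier → List Carrier
  x1s = concatMap (λ x → x ∷ 1# ∷ [])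

  1xs : List Carrier → List Carrier
  1xs = concatMap (λ x → 1# ∷ x ∷ [])

  _⊞_ : Seq → Seq → Seq
  (f ⊞ g) []         = g []
  (f ⊞ g) xs@(_ ∷ _) = ΣB (map (λ τ → cup f g (R τ) (x1s xs)) (Y (length xs)))

  _⊞̲_ : Seq → Seq → Seq
  (f ⊞̲ g) []         = g []
  (f ⊞̲ g) xs@(_ ∷ _) = ΣB (map (λ τ → cup f g (R τ) (1xs xs)) (Y (length xs)))

  _⊞₁_ : Seq → Seq → Seq
  (f ⊞₁ g) []       = 0#
  (f ⊞₁ g) (x ∷ xs) = ΣB (map (λ τ → cup g f (∣ ∨ R τ) (x ∷ 1xs xs)) (Y (length xs)))

  _⊞₂_ : Seq → Seq → Seq
  (f ⊞₂ g) []         = g (1# ∷ [])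
  (f ⊞₂ g) xs@(_ ∷ _) = ΣB (map (λ τ → cup f g (∣ ∨ R τ) (1# ∷ x1s xs)) (Y (length xs)))

{-# OPTIONS --safe #-}
module Submission where

-- Because g = I·G, (f ∪ g)_{S ∨ T}(L, z, D) = (g ∪ f)_S(L) · z · G(…) whenever |L| = |S|, the
-- G-factor depending on T and D only.  Every τ ∈ Y_{m+1} is uniquely σ ∨ ρ with σ ∈ Y_a,
-- ρ ∈ Y_{m-a}, and R(σ ∨ ρ) = (∣ ∨ Rσ) ∨ Rρ with |Rσ| = 2a.  On the interleaved argument list of
-- x₁ … x_{m+1} the left part therefore sees exactly x₁ … x_{a+1} (x₁ … x_a for ⊞̲) and the right
-- part the remaining entries, so summing over σ and ρ independently yields the product
-- (f ⊞₁ g)(x₁ … x_{a+1}) · (f ⊞₂ g)(x_{a+2} … ), resp. (f ⊞₂ g)(x₁ … x_a) · (f ⊞₁ g)(x_{a+1} … ).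
-- These are all terms of the convolution except one, which vanishes since (f ⊞₁ g)_0 = 0.

open import Defs
open import Algebra.Bundles using (Ring)
open import Data.Product using (_×_; _,_)
open import Data.Nat as ℕ using (ℕ; zero; suc; _∸_; _≤_; _<_; s≤s)
open import Data.Nat.Properties
  using (+-suc; m+[n∸m]≡n; m∸n≤m; m≤n⇒m⊓n≡m; m≤n⇒m≤1+n; <⇒≤; ≤-refl)
open import Data.Nat.Induction using (<-rec)
open import Data.Nat.Tactic.RingSolver using (solve-∀)
open import Data.List
  using ( List; []; _∷_; _++_; [_]; _∷ʳ_; map; concat; concatMap; zipWith; reverse; foldr
        ; take; drop; length; upTo; applyUpTo)
open import Data.List.Properties
  using ( unfold-reverse; applyUpTo-∷ʳ; upTo-∷ʳ; map-∘; map-applyUpTo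
        ; length-take; length-drop; take++drop≡id; drop-all)
open import Data.List.Relation.Unary.All as All using (All; []; _∷_)
open import Data.List.Relation.Unary.All.Properties using (applyUpTo⁺₁; applyUpTo⁺₂; concat⁺; map⁺)
open import Function using (id; _∘_)
open import Relation.Binary.PropositionalEquality as ≡ using (_≡_; cong; cong₂)

length-take-≤ : ∀ {ℓ} {X : Set ℓ} {a} {xs : List X} → a ≤ length xs → length (take a xs) ≡ a
length-take-≤ {a = a} {xs} a≤n = ≡.trans (length-take a xs) (m≤n⇒m⊓n≡m a≤n)

length-concatMap-pairs : ∀ {ℓ} {X : Set ℓ} (p q : X → X) xs →
  length (concatMap (λ x → p x ∷ q x ∷ []) xs) ≡ length xs ℕ.+ length xs
length-concatMap-pairs p q []       = ≡.refl
length-concatMap-pairs p q (x ∷ xs) =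
  cong suc (≡.trans (cong suc (length-concatMap-pairs p q xs)) (≡.sym (+-suc _ _)))

module _ {ℓ} {X : Set ℓ} where
  take-length-++ : ∀ (L : List X) W → take (length L) (L ++ W) ≡ L
  take-length-++ []      W = ≡.refl
  take-length-++ (x ∷ L) W = cong (x ∷_) (take-length-++ L W)

  drop-length-++ : ∀ (L : List X) W → drop (length L) (L ++ W) ≡ W
  drop-length-++ []      W = ≡.refl
  drop-length-++ (x ∷ L) W = drop-length-++ L W

  drop-suc-length-++ : ∀ (L : List X) z W → drop (suc (length L)) (L ++ z ∷ W) ≡ W
  drop-suc-length-++ []      z W = ≡.refl
  drop-suc-length-++ (x ∷ L) z W = drop-suc-length-++ L z W

size-R : ∀ σ → size (R σ) ≡ size σ ℕ.+ size σ
size-R ∣       = ≡.refl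
size-R (σ ∨ τ) rewrite size-R σ | size-R τ = lemma (size σ) (size τ)
  where
  lemma : ∀ a c → suc (suc (a ℕ.+ a) ℕ.+ (c ℕ.+ c)) ≡ suc (a ℕ.+ c) ℕ.+ suc (a ℕ.+ c)
  lemma = solve-∀

zipWith-applyUpTo : ∀ {A B C : Set} (h : A → B → C) (p : ℕ → A) (q : ℕ → B) n →
  zipWith h (applyUpTo p n) (applyUpTo q n) ≡ applyUpTo (λ i → h (p i) (q i)) n
zipWith-applyUpTo h p q zero    = ≡.refl
zipWith-applyUpTo h p q (suc n) = cong (h (p 0) (q 0) ∷_) (zipWith-applyUpTo h (p ∘ suc) (q ∘ suc) n)

Ys≡applyUpTo : ∀ m → Ys m ≡ applyUpTo (λ a → Y (m ∸ a)) (suc m)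
Ys≡applyUpTo zero    = ≡.refl
Ys≡applyUpTo (suc m) = cong (Y (suc m) ∷_) (Ys≡applyUpTo m)

reverse-Ys : ∀ m → reverse (Ys m) ≡ applyUpTo Y (suc m)
reverse-Ys zero    = ≡.refl
reverse-Ys (suc m) = ≡.trans (unfold-reverse (Y (suc m)) (Ys m))
  (≡.trans (cong (_∷ʳ Y (suc m)) (reverse-Ys m)) (applyUpTo-∷ʳ Y (suc m)))

Y-suc : ∀ m → Y (suc m) ≡ concat (applyUpTo (λ a → joins (Y a) (Y (m ∸ a))) (suc m))
Y-suc m = cong concat (≡.trans (cong₂ (zipWith joins) (reverse-Ys m) (Ys≡applyUpTo m))
                               (zipWith-applyUpTo joins Y (λ a → Y (m ∸ a)) (suc m)))

length-concatMap-pairs≡size-R : ∀ {ℓ} {X : Set ℓ} (p q : X → X) xs σ → length xs ≡ size σ →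
  length (concatMap (λ x → p x ∷ q x ∷ []) xs) ≡ size (R σ)
length-concatMap-pairs≡size-R p q xs σ |xs|≡|σ| =
  ≡.trans (length-concatMap-pairs p q xs) (≡.trans (cong₂ ℕ._+_ |xs|≡|σ| |xs|≡|σ|) (≡.sym (size-R σ)))

HasSize : ℕ → Tree → Set
HasSize n σ = size σ ≡ n

joins-size : ∀ {a c As Bs} → All (HasSize a) As → All (HasSize c) Bs →
  All (HasSize (suc (a ℕ.+ c))) (joins As Bs)
joins-size sAs sBs =
  concat⁺ (map⁺ (All.map (λ sσ → map⁺ (All.map (λ sρ → cong suc (cong₂ ℕ._+_ sσ sρ)) sBs)) sAs))

Y-size : ∀ n → All (HasSize n) (Y n)
Y-size = <-rec (λ n → All (HasSize n) (Y n)) step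
  where
  step : ∀ n → (∀ {a} → a < n → All (HasSize a) (Y a)) → All (HasSize n) (Y n)
  step zero    _   = ≡.refl ∷ []
  step (suc m) rec = ≡.subst (All (HasSize (suc m))) (≡.sym (Y-suc m))
    (concat⁺ (applyUpTo⁺₁ (λ a → joins (Y a) (Y (m ∸ a))) (suc m) λ { {a} (s≤s a≤m) →
      ≡.subst (λ n → All (HasSize (suc n)) (joins (Y a) (Y (m ∸ a)))) (m+[n∸m]≡n a≤m)
        (joins-size (rec (s≤s a≤m)) (rec (s≤s (m∸n≤m m a)))) }))

module RingSums {c ℓ} (ring : Ring c ℓ) where
  open Ring ring
  open import Relation.Binary.Reasoning.Setoid setoid

  -- Definitionally ΣB ∘ map h, so the sums defining ⊙, ⊞, ⊞̲, ⊞₁, ⊞₂ unfold to ∑.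
  ∑ : {X : Set} → (X → Carrier) → List X → Carrier
  ∑ h l = foldr _+_ 0# (map h l)

  module _ {X : Set} where
    ∑-congᴬ : ∀ {h h' : X → Carrier} {l} → All (λ x → h x ≈ h' x) l → ∑ h l ≈ ∑ h' l
    ∑-congᴬ []       = refl
    ∑-congᴬ (p ∷ ps) = +-cong p (∑-congᴬ ps)

    ∑-cong : ∀ {h h' : X → Carrier} → (∀ x → h x ≈ h' x) → ∀ l → ∑ h l ≈ ∑ h' l
    ∑-cong eq l = ∑-congᴬ (All.universal eq l)

    ∑-zero : ∀ {h : X → Carrier} {l} → All (λ x → h x ≈ 0#) l → ∑ h l ≈ 0#
    ∑-zero []       = refl
    ∑-zero (p ∷ ps) = trans (+-cong p (∑-zero ps)) (+-identityˡ 0#)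

    ∑-++ : ∀ (h : X → Carrier) xs ys → ∑ h (xs ++ ys) ≈ ∑ h xs + ∑ h ys
    ∑-++ h []       ys = sym (+-identityˡ _)
    ∑-++ h (x ∷ xs) ys = trans (+-congˡ (∑-++ h xs ys)) (sym (+-assoc _ _ _))

    ∑-concat : ∀ (h : X → Carrier) ls → ∑ h (concat ls) ≈ ∑ (∑ h) ls
    ∑-concat h []       = refl
    ∑-concat h (l ∷ ls) = trans (∑-++ h l (concat ls)) (+-congˡ (∑-concat h ls))

    ∑-map : ∀ {W : Set} (h : X → Carrier) (k : W → X) l → ∑ h (map k l) ≡ ∑ (h ∘ k) l
    ∑-map h k l = cong (foldr _+_ 0#) (≡.sym (map-∘ l))

    ∑-applyUpTo : ∀ (h : X → Carrier) (k : ℕ → X) n → ∑ h (applyUpTo k n) ≡ ∑ (h ∘ k) (upTo n)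
    ∑-applyUpTo h k n = cong (foldr _+_ 0#)
      (≡.trans (map-applyUpTo k h n) (≡.sym (map-applyUpTo id (h ∘ k) n)))

    ∑-*ˡ : ∀ x (h : X → Carrier) l → x * ∑ h l ≈ ∑ (λ y → x * h y) l
    ∑-*ˡ x h []      = zeroʳ x
    ∑-*ˡ x h (y ∷ l) = trans (distribˡ _ _ _) (+-congˡ (∑-*ˡ x h l))

    ∑-*ʳ : ∀ (h : X → Carrier) x l → ∑ h l * x ≈ ∑ (λ y → h y * x) l
    ∑-*ʳ h x []      = zeroˡ x
    ∑-*ʳ h x (y ∷ l) = trans (distribʳ _ _ _) (+-congˡ (∑-*ʳ h x l))

  ∑-∑-factor : ∀ {X Z : Set} {h : X → Z → Carrier} {u : X → Carrier} {v : Z → Carrier} {xs} zs →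
    All (λ x → ∀ z → h x z ≈ u x * v z) xs → ∑ (λ x → ∑ (h x) zs) xs ≈ ∑ u xs * ∑ v zs
  ∑-∑-factor {h = h} {u} {v} {xs} zs factor = begin
    ∑ (λ x → ∑ (h x) zs) xs            ≈⟨ ∑-congᴬ (All.map (λ hx → ∑-cong hx zs) factor) ⟩
    ∑ (λ x → ∑ (λ z → u x * v z) zs) xs ≈⟨ ∑-cong (λ x → sym (∑-*ˡ (u x) v zs)) xs ⟩
    ∑ (λ x → u x * ∑ v zs) xs           ≈⟨ sym (∑-*ʳ u (∑ v zs) xs) ⟩
    ∑ u xs * ∑ v zs                     ∎

  ∑-joins : ∀ (h : Tree → Carrier) As Bs →
    ∑ h (joins As Bs) ≈ ∑ (λ σ → ∑ (λ ρ → h (σ ∨ ρ)) Bs) As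
  ∑-joins h As Bs = begin
    ∑ h (concat (map (λ σ → map (σ ∨_) Bs) As)) ≈⟨ ∑-concat h (map (λ σ → map (σ ∨_) Bs) As) ⟩
    ∑ (∑ h) (map (λ σ → map (σ ∨_) Bs) As)      ≡⟨ ∑-map (∑ h) (λ σ → map (σ ∨_) Bs) As ⟩
    ∑ (λ σ → ∑ h (map (σ ∨_) Bs)) As            ≈⟨ ∑-cong (λ σ → reflexive (∑-map h (σ ∨_) Bs)) As ⟩
    ∑ (λ σ → ∑ (λ ρ → h (σ ∨ ρ)) Bs) As         ∎

  ∑-Y-suc-factor : ∀ m (h : Tree → Carrier) (u v : ℕ → Tree → Carrier) →
    (∀ {a σ} → a ≤ m → HasSize a σ → ∀ ρ → h (σ ∨ ρ) ≈ u a σ * v a ρ) →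
    ∑ h (Y (suc m)) ≈ ∑ (λ a → ∑ (u a) (Y a) * ∑ (v a) (Y (m ∸ a))) (upTo (suc m))
  ∑-Y-suc-factor m h u v factor = begin
    ∑ h (Y (suc m))                      ≡⟨ cong (∑ h) (Y-suc m) ⟩
    ∑ h (concat (applyUpTo J (suc m)))   ≈⟨ ∑-concat h (applyUpTo J (suc m)) ⟩
    ∑ (∑ h) (applyUpTo J (suc m))        ≡⟨ ∑-applyUpTo (∑ h) J (suc m) ⟩
    ∑ (λ a → ∑ h (J a)) (upTo (suc m))
      ≈⟨ ∑-congᴬ (applyUpTo⁺₁ id (suc m) λ { (s≤s a≤m) → joins-factor a≤m }) ⟩
    ∑ (λ a → ∑ (u a) (Y a) * ∑ (v a) (Y (m ∸ a))) (upTo (suc m)) ∎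
    where
    J : ℕ → List Tree
    J a = joins (Y a) (Y (m ∸ a))
    joins-factor : ∀ {a} → a ≤ m → ∑ h (J a) ≈ ∑ (u a) (Y a) * ∑ (v a) (Y (m ∸ a))
    joins-factor {a} a≤m =
      trans (∑-joins h (Y a) (Y (m ∸ a))) (∑-∑-factor (Y (m ∸ a)) (All.map (factor a≤m) (Y-size a)))

module Factorisation {k ℓk b ℓb} {K : Field k ℓk} (A : UnitalAlgebra K b ℓb) where
  open UnitalAlgebra A
  open Series A
  open Convolutions A
  open RingSums ring
  open import Relation.Binary.Reasoning.Setoid setoid

  I⊙-[] : ∀ F → (I ⊙ F) [] ≈ 0#
  I⊙-[] F = trans (+-identityʳ _) (zeroˡ _)

  I⊙-∷ : ∀ F y ys → (I ⊙ F) (y ∷ ys) ≈ y * F ys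
  I⊙-∷ F y []       = trans (+-cong (zeroˡ _) (+-identityʳ _)) (+-identityˡ _)
  I⊙-∷ F y (z ∷ zs) =
    trans (+-cong (zeroˡ _) (+-congˡ (∑-zero {h = T} (applyUpTo⁺₂ (suc ∘ suc) (suc (length zs)) λ _ → zeroˡ _))))
          (trans (+-identityˡ _) (+-identityʳ _))
    where
    T : ℕ → Carrier
    T j = I (take j (y ∷ z ∷ zs)) * F (drop j (y ∷ z ∷ zs))

  ⊙-dropFirst : ∀ {P Q} → P [] ≈ 0# → ∀ x xs →
    (P ⊙ Q) (x ∷ xs) ≈ ∑ (λ a → P (x ∷ take a xs) * Q (drop a xs)) (upTo (suc (length xs)))
  ⊙-dropFirst {P} {Q} P[]≈0 x xs = begin
    P [] * Q (x ∷ xs) + ∑ T (applyUpTo suc (suc n)) ≈⟨ +-cong (trans (*-congʳ P[]≈0) (zeroˡ _))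
                                                              (reflexive (∑-applyUpTo T suc (suc n))) ⟩
    0# + ∑ (T ∘ suc) (upTo (suc n))                 ≈⟨ +-identityˡ _ ⟩
    ∑ (T ∘ suc) (upTo (suc n))                      ∎
    where
    n : ℕ
    n = length xs
    T : ℕ → Carrier
    T j = P (take j (x ∷ xs)) * Q (drop j (x ∷ xs))

  ⊙-dropLast : ∀ {Q P} → P [] ≈ 0# → ∀ xs →
    (Q ⊙ P) xs ≈ ∑ (λ a → Q (take a xs) * P (drop a xs)) (upTo (length xs))
  ⊙-dropLast {Q} {P} P[]≈0 xs = begin
    ∑ T (upTo (suc n))        ≡⟨ cong (∑ T) (≡.sym (upTo-∷ʳ n)) ⟩
    ∑ T (upTo n ∷ʳ n)         ≈⟨ ∑-++ T (upTo n) [ n ] ⟩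
    ∑ T (upTo n) + (T n + 0#) ≈⟨ +-congˡ (trans (+-identityʳ _) last≈0) ⟩
    ∑ T (upTo n) + 0#         ≈⟨ +-identityʳ _ ⟩
    ∑ T (upTo n)              ∎
    where
    n : ℕ
    n = length xs
    T : ℕ → Carrier
    T j = Q (take j xs) * P (drop j xs)
    last≈0 : T n ≈ 0#
    last≈0 = trans (*-congˡ (trans (reflexive (cong P (drop-all n xs ≤-refl))) P[]≈0)) (zeroʳ _)

  1∷x1s-++ : ∀ ys zs → 1# ∷ x1s (ys ++ zs) ≡ 1xs ys ++ 1# ∷ x1s zs
  1∷x1s-++ []       zs = ≡.refl
  1∷x1s-++ (y ∷ ys) zs = cong (λ l → 1# ∷ y ∷ l) (1∷x1s-++ ys zs)

  1xs-++-∷ : ∀ ys z zs → 1xs (ys ++ z ∷ zs) ≡ (1# ∷ x1s ys) ++ z ∷ 1xs zs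
  1xs-++-∷ []       z zs = ≡.refl
  1xs-++-∷ (y ∷ ys) z zs = cong (λ l → 1# ∷ y ∷ l) (1xs-++-∷ ys z zs)

  drop-∷ : ∀ a xs → a < length xs → drop a xs ≡ headOr (drop a xs) ∷ drop (suc a) xs
  drop-∷ zero    (x ∷ xs) _         = ≡.refl
  drop-∷ (suc a) (x ∷ xs) (s≤s a<n) = drop-∷ a xs a<n

  cup-∨-++ : ∀ p q S T {L} z D → length L ≡ size S →
    cup p q (S ∨ T) (L ++ z ∷ D) ≡ q ((cup q p S L * z) ∷ cupArgs p q T D)
  cup-∨-++ p q S T {L} z D |L|≡|S| = ≡.trans (cong unfolded (≡.sym |L|≡|S|))
    (cong q (cong₂ _∷_ (cong₂ (λ l w → cup q p S l * w) (take-length-++ L W) (cong headOr (drop-length-++ L W)))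
                       (cong (cupArgs p q T) (drop-suc-length-++ L z D))))
    where
    W : List Carrier
    W = z ∷ D
    -- cup p q (S ∨ T) (L ++ W) is unfolded (size S) by definition.
    unfolded : ℕ → Carrier
    unfolded n = q ((cup q p S (take n (L ++ W)) * headOr (drop n (L ++ W))) ∷ cupArgs p q T (drop (suc n) (L ++ W)))

  cup-∣∨ : ∀ p {q} Q → (∀ xs → q xs ≈ (I ⊙ Q) xs) →
    ∀ S y L → cup p q (∣ ∨ S) (y ∷ L) ≈ y * Q (cupArgs p q S L)
  cup-∣∨ p Q q≈IQ S y L = trans (q≈IQ _) (trans (I⊙-∷ Q _ _) (*-congʳ (*-identityˡ y)))

  module _ (f g F G : Seq) (f≈IF : ∀ xs → f xs ≈ (I ⊙ F) xs) (g≈IG : ∀ xs → g xs ≈ (I ⊙ G) xs) where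

    ⊞₁-∷ : ∀ y ys → (f ⊞₁ g) (y ∷ ys) ≈ ∑ (λ ρ → y * F (cupArgs g f (R ρ) (1xs ys))) (Y (length ys))
    ⊞₁-∷ y ys = ∑-cong (λ ρ → cup-∣∨ g F f≈IF (R ρ) y (1xs ys)) (Y (length ys))

    ⊞₂-∑ : ∀ ys → (f ⊞₂ g) ys ≈ ∑ (λ ρ → G (cupArgs f g (R ρ) (x1s ys))) (Y (length ys))
    ⊞₂-∑ []         = trans (g≈IG _) (trans (I⊙-∷ G 1# []) (trans (*-identityˡ _) (sym (+-identityʳ _))))
    ⊞₂-∑ ys@(_ ∷ _) =
      ∑-cong (λ ρ → trans (cup-∣∨ f G g≈IG (R ρ) 1# (x1s ys)) (*-identityˡ _)) (Y (length ys))

    cup-R-∨-x1s : ∀ σ ρ x T D → length T ≡ size σ →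
      cup f g (R (σ ∨ ρ)) (x1s (x ∷ T ++ D)) ≈ cup g f (∣ ∨ R σ) (x ∷ 1xs T) * G (cupArgs f g (R ρ) (x1s D))
    cup-R-∨-x1s σ ρ x T D |T|≡|σ| = begin
      cup f g (R (σ ∨ ρ)) (x ∷ 1# ∷ x1s (T ++ D))
        ≡⟨ cong (λ l → cup f g (R (σ ∨ ρ)) (x ∷ l)) (1∷x1s-++ T D) ⟩
      cup f g (R (σ ∨ ρ)) ((x ∷ 1xs T) ++ 1# ∷ x1s D)
        ≡⟨ cup-∨-++ f g (∣ ∨ R σ) (R ρ) 1# (x1s D) fits ⟩
      g ((cup g f (∣ ∨ R σ) (x ∷ 1xs T) * 1#) ∷ cupArgs f g (R ρ) (x1s D))
        ≈⟨ trans (g≈IG _) (I⊙-∷ G _ _) ⟩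
      (cup g f (∣ ∨ R σ) (x ∷ 1xs T) * 1#) * G (cupArgs f g (R ρ) (x1s D))
        ≈⟨ *-congʳ (*-identityʳ _) ⟩
      cup g f (∣ ∨ R σ) (x ∷ 1xs T) * G (cupArgs f g (R ρ) (x1s D)) ∎
      where
      fits : length (x ∷ 1xs T) ≡ size (∣ ∨ R σ)
      fits = cong suc (length-concatMap-pairs≡size-R _ _ T σ |T|≡|σ|)

    cup-R-∨-1xs : ∀ σ ρ T z D → length T ≡ size σ →
      cup g f (R (σ ∨ ρ)) (1xs (T ++ z ∷ D)) ≈ G (cupArgs f g (R σ) (x1s T)) * (z * F (cupArgs g f (R ρ) (1xs D)))
    cup-R-∨-1xs σ ρ T z D |T|≡|σ| = begin
      cup g f (R (σ ∨ ρ)) (1xs (T ++ z ∷ D))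
        ≡⟨ cong (cup g f (R (σ ∨ ρ))) (1xs-++-∷ T z D) ⟩
      cup g f (R (σ ∨ ρ)) ((1# ∷ x1s T) ++ z ∷ 1xs D)
        ≡⟨ cup-∨-++ g f (∣ ∨ R σ) (R ρ) z (1xs D) fits ⟩
      f ((cup f g (∣ ∨ R σ) (1# ∷ x1s T) * z) ∷ cupArgs g f (R ρ) (1xs D))
        ≈⟨ trans (f≈IF _) (I⊙-∷ F _ _) ⟩
      (cup f g (∣ ∨ R σ) (1# ∷ x1s T) * z) * F (cupArgs g f (R ρ) (1xs D))
        ≈⟨ *-assoc _ _ _ ⟩
      cup f g (∣ ∨ R σ) (1# ∷ x1s T) * (z * F (cupArgs g f (R ρ) (1xs D)))
        ≈⟨ *-congʳ (trans (cup-∣∨ f G g≈IG (R σ) 1# (x1s T)) (*-identityˡ _)) ⟩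
      G (cupArgs f g (R σ) (x1s T)) * (z * F (cupArgs g f (R ρ) (1xs D))) ∎
      where
      fits : length (1# ∷ x1s T) ≡ size (∣ ∨ R σ)
      fits = cong suc (length-concatMap-pairs≡size-R _ _ T σ |T|≡|σ|)

    ⊞-factorises : ∀ xs → (f ⊞ g) xs ≈ ((f ⊞₁ g) ⊙ (f ⊞₂ g)) xs
    ⊞-factorises []         = trans (trans (g≈IG []) (I⊙-[] G)) (sym (trans (+-identityʳ _) (zeroˡ _)))
    ⊞-factorises (x ∷ rest) = begin
      (f ⊞ g) (x ∷ rest)
        ≈⟨ ∑-Y-suc-factor m _ u v factor ⟩
      ∑ (λ a → ∑ (u a) (Y a) * ∑ (v a) (Y (m ∸ a))) (upTo (suc m))
        ≈⟨ ∑-congᴬ (applyUpTo⁺₁ id (suc m) λ { {a} (s≤s a≤m) →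
             *-cong (⊞₁-take a≤m) (⊞₂-drop a) }) ⟩
      ∑ (λ a → (f ⊞₁ g) (x ∷ take a rest) * (f ⊞₂ g) (drop a rest)) (upTo (suc m))
        ≈⟨ sym (⊙-dropFirst {f ⊞₁ g} {f ⊞₂ g} refl x rest) ⟩
      ((f ⊞₁ g) ⊙ (f ⊞₂ g)) (x ∷ rest) ∎
      where
      m : ℕ
      m = length rest
      u v : ℕ → Tree → Carrier
      u a σ = cup g f (∣ ∨ R σ) (x ∷ 1xs (take a rest))
      v a ρ = G (cupArgs f g (R ρ) (x1s (drop a rest)))
      factor : ∀ {a σ} → a ≤ m → HasSize a σ →
        ∀ ρ → cup f g (R (σ ∨ ρ)) (x1s (x ∷ rest)) ≈ u a σ * v a ρ
      factor {a} {σ} a≤m |σ|≡a ρ =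
        trans (reflexive (cong (λ l → cup f g (R (σ ∨ ρ)) (x1s (x ∷ l))) (≡.sym (take++drop≡id a rest))))
              (cup-R-∨-x1s σ ρ x (take a rest) (drop a rest) (≡.trans (length-take-≤ a≤m) (≡.sym |σ|≡a)))
      ⊞₁-take : ∀ {a} → a ≤ m → ∑ (u a) (Y a) ≈ (f ⊞₁ g) (x ∷ take a rest)
      ⊞₁-take {a} a≤m = reflexive (cong (λ n → ∑ (u a) (Y n)) (≡.sym (length-take-≤ a≤m)))
      ⊞₂-drop : ∀ a → ∑ (v a) (Y (m ∸ a)) ≈ (f ⊞₂ g) (drop a rest)
      ⊞₂-drop a =
        sym (trans (⊞₂-∑ (drop a rest)) (reflexive (cong (λ n → ∑ (v a) (Y n)) (length-drop a rest))))

    ⊞̲-factorises : ∀ xs → (g ⊞̲ f) xs ≈ ((f ⊞₂ g) ⊙ (f ⊞₁ g)) xs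
    ⊞̲-factorises []            = trans (trans (f≈IF []) (I⊙-[] F)) (sym (trans (+-identityʳ _) (zeroʳ _)))
    ⊞̲-factorises xs@(x ∷ rest) = begin
      (g ⊞̲ f) xs
        ≈⟨ ∑-Y-suc-factor m _ u v factor ⟩
      ∑ (λ a → ∑ (u a) (Y a) * ∑ (v a) (Y (m ∸ a))) (upTo (suc m))
        ≈⟨ ∑-congᴬ (applyUpTo⁺₁ id (suc m) λ a<n → *-cong (⊞₂-take a<n) (⊞₁-drop a<n)) ⟩
      ∑ (λ a → (f ⊞₂ g) (take a xs) * (f ⊞₁ g) (drop a xs)) (upTo (length xs))
        ≈⟨ sym (⊙-dropLast {f ⊞₂ g} {f ⊞₁ g} refl xs) ⟩
      ((f ⊞₂ g) ⊙ (f ⊞₁ g)) xs ∎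
      where
      m : ℕ
      m = length rest
      z : ℕ → Carrier
      z a = headOr (drop a xs)
      u v : ℕ → Tree → Carrier
      u a σ = G (cupArgs f g (R σ) (x1s (take a xs)))
      v a ρ = z a * F (cupArgs g f (R ρ) (1xs (drop (suc a) xs)))
      split : ∀ {a} → a < length xs → xs ≡ take a xs ++ z a ∷ drop (suc a) xs
      split {a} a<n = ≡.trans (≡.sym (take++drop≡id a xs)) (cong (take a xs ++_) (drop-∷ a xs a<n))
      factor : ∀ {a σ} → a ≤ m → HasSize a σ →
        ∀ ρ → cup g f (R (σ ∨ ρ)) (1xs xs) ≈ u a σ * v a ρ
      factor {a} {σ} a≤m |σ|≡a ρ =
        trans (reflexive (cong (λ l → cup g f (R (σ ∨ ρ)) (1xs l)) (split (s≤s a≤m))))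
              (cup-R-∨-1xs σ ρ (take a xs) (z a) (drop (suc a) xs)
                           (≡.trans (length-take-≤ (m≤n⇒m≤1+n a≤m)) (≡.sym |σ|≡a)))
      ⊞₂-take : ∀ {a} → a < length xs → ∑ (u a) (Y a) ≈ (f ⊞₂ g) (take a xs)
      ⊞₂-take {a} a<n =
        sym (trans (⊞₂-∑ (take a xs)) (reflexive (cong (λ n → ∑ (u a) (Y n)) (length-take-≤ (<⇒≤ a<n)))))
      ⊞₁-drop : ∀ {a} → a < length xs → ∑ (v a) (Y (m ∸ a)) ≈ (f ⊞₁ g) (drop a xs)
      ⊞₁-drop {a} a<n = sym (begin
        (f ⊞₁ g) (drop a xs)                ≡⟨ cong (f ⊞₁ g) (drop-∷ a xs a<n) ⟩
        (f ⊞₁ g) (z a ∷ drop a rest)        ≈⟨ ⊞₁-∷ (z a) (drop a rest) ⟩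
        ∑ (v a) (Y (length (drop a rest)))  ≡⟨ cong (λ n → ∑ (v a) (Y n)) (length-drop a rest) ⟩
        ∑ (v a) (Y (m ∸ a))                 ∎)

lemma3p22 : ∀ {k ℓk b ℓb} (K : Field k ℓk) → CharZero K →
    (A : UnitalAlgebra K b ℓb) →
    let open UnitalAlgebra A using (_≈_)
        open Series A
        open Convolutions A
    in (f g : Seq) → InIMult f → InIMult g →
       (∀ xs → (f ⊞ g) xs ≈ ((f ⊞₁ g) ⊙ (f ⊞₂ g)) xs)
       × (∀ xs → (g ⊞̲ f) xs ≈ ((f ⊞₂ g) ⊙ (f ⊞₁ g)) xs)
lemma3p22 K _ A f g (F , _ , f≈IF) (G , _ , g≈IG) =
  ⊞-factorises f g F G f≈IF g≈IG , ⊞̲-factorises f g F G f≈IF g≈IG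
  where open Factorisation A
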